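{- The family of noncrossing set partitions of $\{1,\dots,n\}$, $n\ge0$ (viewed as standard s-partitions with increasing blocks), is a run-closed family whose only run-free member is the empty partition.
   Context: A set partition of $\{1,\dots,n\}$ is noncrossing if there are no $a<b<c<d$ with $a,c$ in one block and $b,d$ in another. A standard s-partition is a partition of $\{1,\dots,n\}$ into a set of lists; a set partition is viewed as one with each block listed increasingly. A run is a block consisting of consecutive integers in increasing order. Deleting a run means removing that block and standardizing the rest (relabeling entries order-preservingly by $1,2,\dots$); inserting the run $i+1,\dots,i+\ell$ ($0\le i\le$ size) means increasing by $\ell$ all entries exceeding $i$ and adjoining $i+1,\dots,i+\ell$ as a new block. A run-closed family is a set of standard s-partitions closed under insertion and deletion of runs; a member is run-free if it has no run. -}

module Defs where

open import Data.Nat using (ℕ; zero; suc; _+_; _∸_; _≤_; _<_; _≤ᵇ_)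
open import Data.Bool using (if_then_else_)
open import Data.List using (List; []; _∷_; _++_; map; concat; length; upTo; lookup)
open import Data.List.Membership.Propositional using (_∈_)
open import Data.List.Relation.Unary.All using (All)
open import Data.List.Relation.Unary.Linked using (Linked)
open import Data.List.Relation.Binary.Permutation.Propositional using (_↭_)
open import Data.Fin using (Fin)
open import Data.Product using (_×_; ∃; ∃-syntax)
open import Relation.Binary.PropositionalEquality using (_≡_; _≢_)
open import Relation.Nullary using (¬_)
open import Data.Empty using (⊥)

-- The blocks form a *set*; we represent it as a list of blocks, and every
-- notion below is insensitive to the order of the blocks.
SPart : Set
SPart = List (List ℕ)

size : SPart → ℕ
size P = length (concat P)

run : ℕ → ℕ → List ℕ
run i ℓ = map (λ k → i + suc k) (upTo ℓ)

data NonEmpty {A : Set} : List A → Set where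
  nonempty : ∀ x xs → NonEmpty (x ∷ xs)

IsStdSPart : SPart → Set
IsStdSPart P = All NonEmpty P × (concat P ↭ run 0 (size P))

IsRun : List ℕ → Set
IsRun B = ∃[ i ] ∃[ ℓ ] (1 ≤ ℓ × B ≡ run i ℓ)

RunFree : SPart → Set
RunFree P = All (λ B → ¬ IsRun B) P

shiftUp : ℕ → ℕ → ℕ → ℕ
shiftUp i ℓ x = if x ≤ᵇ i then x else x + ℓ

insertRun : ℕ → ℕ → SPart → SPart
insertRun i ℓ P = run i ℓ ∷ map (map (shiftUp i ℓ)) P

-- deleting the run i+1..i+ℓ and standardizing the rest: the remaining entries
-- are {1..n} \ {i+1..i+ℓ}, whose order-preserving relabelling by 1,2,...
-- decreases by ℓ every entry exceeding i.
shiftDown : ℕ → ℕ → ℕ → ℕ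
shiftDown i ℓ x = if x ≤ᵇ i then x else x ∸ ℓ

standardizeAfterDeleting : ℕ → ℕ → SPart → SPart
standardizeAfterDeleting i ℓ Q = map (map (shiftDown i ℓ)) Q

RunClosed : (SPart → Set) → Set
RunClosed F =
  (∀ P → F P → IsStdSPart P)
  × (∀ P i ℓ → F P → i ≤ size P → 1 ≤ ℓ → F (insertRun i ℓ P))
  × (∀ Q R i ℓ → 1 ≤ ℓ → F (Q ++ run i ℓ ∷ R)
       → F (standardizeAfterDeleting i ℓ (Q ++ R)))

NonCrossing : SPart → Set
NonCrossing P =
  (j k : Fin (length P)) → j ≢ k →
  (a b c d : ℕ) → a < b → b < c → c < d →
  a ∈ lookup P j → c ∈ lookup P j → b ∈ lookup P k → d ∈ lookup P k → ⊥

NC : SPart → Set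
NC P = IsStdSPart P × All (Linked _<_) P × NonCrossing P

-- A run inserted after i shifts every entry above i up by its length: an order embedding whose
-- image avoids the interval of the run; deleting the run is the inverse on the surviving entries.
-- Such maps keep blocks increasing and reflect crossings, and a run, being an interval, crosses
-- no block that avoids it, so noncrossing partitions are closed under both operations, while
-- standardness is a permutation identity between runs. Conversely, a block of a noncrossing
-- partition that is not a run has a gap p < q with p + 1 outside it; the block of p + 1 is then
-- enclosed strictly between p and q, so iterating produces blocks in ever narrower windows,
-- which is absurd.

module Submission where

open import Defs
open import Data.Nat using (ℕ; zero; suc; _+_; _∸_; _≤_; _<_; _≤ᵇ_; s≤s; z≤n; z<s; s≤s⁻¹; _≤?_)
open import Data.Nat.Properties
open import Data.Bool using (true; false; if_then_else_)
open import Data.Fin using (Fin; zero; suc)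
import Data.Fin.Properties as Fin
open import Data.List using (List; []; _∷_; _++_; map; concat; length; upTo; applyUpTo; lookup)
open import Data.List.Properties
  using ( map-++; map-∘; map-cong; map-cong-local; map-upTo; map-applyUpTo
        ; length-map; length-upTo; concat-map; concat-++)
open import Data.List.Membership.Propositional using (_∈_; _∉_)
open import Data.List.Membership.Propositional.Properties
  using (∈-map⁻; ∈-upTo⁻; ∈-++⁺ˡ; ∈-++⁺ʳ; ∈-++⁻; ∈-concat⁺′; ∈-concat⁻′; ∈-lookup)
open import Data.List.Relation.Unary.All as All using (All; []; _∷_)
import Data.List.Relation.Unary.All.Properties as All
open import Data.List.Relation.Unary.Any using (here; there; index)
open import Data.List.Relation.Unary.Any.Properties using (lookup-index)
open import Data.List.Relation.Unary.Linked using (Linked; []; [-]; _∷_)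
import Data.List.Relation.Unary.Linked.Properties as Linked
open import Data.List.Relation.Unary.AllPairs using ([]; _∷_)
open import Data.List.Relation.Unary.Unique.Propositional using (Unique)
import Data.List.Relation.Unary.Unique.Propositional.Properties as Unique
open import Data.List.Relation.Binary.Permutation.Propositional
  using (_↭_; ↭-sym; ↭⇒↭ₛ; module PermutationReasoning)
open import Data.List.Relation.Binary.Permutation.Propositional.Properties
  using (∈-resp-↭; ↭-length; map⁺; ++⁺ˡ; shifts; drop-∷)
import Data.List.Relation.Binary.Permutation.Setoid.Properties as PermutationSetoid
open import Data.Product using (_×_; _,_; proj₁; proj₂; ∃; ∃₂)
open import Data.Sum using (_⊎_; inj₁; inj₂; [_,_]′)
open import Function using (_∘_; id)
open import Algebra.Properties.CommutativeSemigroup +-commutativeSemigroup using (xy∙z≈xz∙y)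
open import Relation.Binary.Core using (_Preserves_⟶_)
open import Relation.Binary.Definitions using (tri<; tri≈; tri>)
open import Relation.Binary.PropositionalEquality
open import Relation.Nullary using (¬_; yes; no; contradiction)
open import Relation.Nullary.Reflects using (ofʸ; ofⁿ)

private variable
  P Q R : SPart
  B C X : List ℕ

strictMono⇒mono : ∀ {f : ℕ → ℕ} → f Preserves _<_ ⟶ _<_ → f Preserves _≤_ ⟶ _≤_
strictMono⇒mono f-mono x≤y with m≤n⇒m<n∨m≡n x≤y
... | inj₁ x<y  = <⇒≤ (f-mono x<y)
... | inj₂ refl = ≤-refl

strictMono⇒cancel-< : ∀ {f : ℕ → ℕ} → f Preserves _<_ ⟶ _<_ → ∀ {x y} → f x < f y → x < y
strictMono⇒cancel-< f-mono fx<fy = ≰⇒> (λ y≤x → <⇒≱ fx<fy (strictMono⇒mono f-mono y≤x))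

if-≤ᵇ-≤ : ∀ {A : Set} {x i} {u v : A} → x ≤ i → (if x ≤ᵇ i then u else v) ≡ u
if-≤ᵇ-≤ {x = x} {i} x≤i with x ≤ᵇ i | ≤ᵇ-reflects-≤ x i
... | true  | _        = refl
... | false | ofⁿ x≰i = contradiction x≤i x≰i

if-≤ᵇ-> : ∀ {A : Set} {x i} {u v : A} → i < x → (if x ≤ᵇ i then u else v) ≡ v
if-≤ᵇ-> {x = x} {i} i<x with x ≤ᵇ i | ≤ᵇ-reflects-≤ x i
... | true  | ofʸ x≤i = contradiction x≤i (<⇒≱ i<x)
... | false | _        = refl

++-cancelˡ-↭ : ∀ {A : Set} (xs : List A) {ys zs} → xs ++ ys ↭ xs ++ zs → ys ↭ zs
++-cancelˡ-↭ []       p = p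
++-cancelˡ-↭ (x ∷ xs) p = ++-cancelˡ-↭ xs (drop-∷ p)

NonEmpty-map : ∀ {A B : Set} {h : A → B} {xs} → NonEmpty xs → NonEmpty (map h xs)
NonEmpty-map {h = h} (nonempty x xs) = nonempty (h x) (map h xs)

linked-map : ∀ {h : ℕ → ℕ} {B} → (∀ {x y} → x ∈ B → y ∈ B → x < y → h x < h y) →
             Linked _<_ B → Linked _<_ (map h B)
linked-map mono []          = []
linked-map mono [-]         = [-]
linked-map mono (x<y ∷ xs<) =
  mono (here refl) (there (here refl)) x<y ∷ linked-map (λ x∈ y∈ → mono (there x∈) (there y∈)) xs<

All-remove : ∀ {A : Set} {P : A → Set} Q {X R} → All P (Q ++ X ∷ R) → All P (Q ++ R)
All-remove Q all = All.++⁺ (All.++⁻ˡ Q all) (All.tail (All.++⁻ʳ Q all))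

unique-++-disjoint : ∀ {A : Set} xs {ys : List A} {x} → Unique (xs ++ ys) → x ∈ xs → x ∉ ys
unique-++-disjoint (y ∷ xs) (y∉ ∷ _) (here refl) x∈ys = All.lookup y∉ (∈-++⁺ʳ xs x∈ys) refl
unique-++-disjoint (y ∷ xs) (_ ∷ u)  (there x∈xs) = unique-++-disjoint xs u x∈xs

unique-++ʳ : ∀ {A : Set} xs {ys : List A} → Unique (xs ++ ys) → Unique ys
unique-++ʳ []       u       = u
unique-++ʳ (x ∷ xs) (_ ∷ u) = unique-++ʳ xs u

∈-insert : ∀ {A : Set} {x : A} ys {zs y} → x ∈ ys ++ zs → x ∈ ys ++ y ∷ zs
∈-insert ys x∈ = [ ∈-++⁺ˡ , ∈-++⁺ʳ ys ∘ there ]′ (∈-++⁻ ys x∈)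

-- Runs

run-suc : ∀ i ℓ → run i (suc ℓ) ≡ suc i ∷ run (suc i) ℓ
run-suc i ℓ = cong₂ _∷_ (+-comm i 1) (begin
  map (λ t → i + suc t) (applyUpTo suc ℓ) ≡⟨ map-applyUpTo suc _ ℓ ⟩
  applyUpTo (λ t → i + suc (suc t)) ℓ     ≡⟨ map-upTo _ ℓ ⟨
  map (λ t → i + suc (suc t)) (upTo ℓ)    ≡⟨ map-cong (λ t → +-suc i (suc t)) (upTo ℓ) ⟩
  run (suc i) ℓ                           ∎)
  where open ≡-Reasoning

length-run : ∀ i ℓ → length (run i ℓ) ≡ ℓ
length-run i ℓ = trans (length-map _ (upTo ℓ)) (length-upTo ℓ)

∈-run⁻ : ∀ {i ℓ x} → x ∈ run i ℓ → i < x × x ≤ i + ℓ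
∈-run⁻ {i} x∈ with t , t∈ , refl ← ∈-map⁻ _ x∈ = m<m+n i z<s , +-monoʳ-≤ i (∈-upTo⁻ t∈)

∈-run⁺ : ∀ {i ℓ x} → i < x → x ≤ i + ℓ → x ∈ run i ℓ
∈-run⁺ {i} {zero} {x} i<x x≤i+0 = contradiction (subst (x ≤_) (+-identityʳ i) x≤i+0) (<⇒≱ i<x)
∈-run⁺ {i} {suc ℓ} {x} i<x x≤i+ℓ rewrite run-suc i ℓ with x ≟ suc i
... | yes refl = here refl
... | no x≢1+i = there (∈-run⁺ (≤∧≢⇒< i<x (x≢1+i ∘ sym)) (subst (x ≤_) (+-suc i ℓ) x≤i+ℓ))

run-nonempty : ∀ i ℓ → NonEmpty (run i (suc ℓ))
run-nonempty i ℓ = subst NonEmpty (sym (run-suc i ℓ)) (nonempty (suc i) (run (suc i) ℓ))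

run-unique : ∀ i ℓ → Unique (run i ℓ)
run-unique i ℓ = Unique.map⁺ (suc-injective ∘ +-cancelˡ-≡ i _ _) (Unique.upTo⁺ ℓ)

run-linked : ∀ i ℓ → Linked _<_ (run i ℓ)
run-linked i ℓ = Linked.map⁺ (Linked.applyUpTo⁺₂ id ℓ (λ t → +-monoʳ-< i (n<1+n (suc t))))

run-convex : ∀ {i ℓ x y z} → x ∈ run i ℓ → y ∈ run i ℓ → x < z → z < y → z ∈ run i ℓ
run-convex x∈ y∈ x<z z<y = ∈-run⁺ (<-trans (proj₁ (∈-run⁻ x∈)) x<z) (≤-trans (<⇒≤ z<y) (proj₂ (∈-run⁻ y∈)))

run-++ : ∀ i m k → run i (m + k) ≡ run i m ++ run (i + m) k
run-++ i zero    k = cong (λ j → run j k) (sym (+-identityʳ i))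
run-++ i (suc m) k = begin
  run i (suc (m + k))                         ≡⟨ run-suc i (m + k) ⟩
  suc i ∷ run (suc i) (m + k)                 ≡⟨ cong (suc i ∷_) (run-++ (suc i) m k) ⟩
  suc i ∷ run (suc i) m ++ run (suc i + m) k  ≡⟨ cong (λ j → suc i ∷ run (suc i) m ++ run j k) (+-suc i m) ⟨
  suc i ∷ run (suc i) m ++ run (i + suc m) k  ≡⟨ cong (_++ run (i + suc m) k) (run-suc i m) ⟨
  run i (suc m) ++ run (i + suc m) k          ∎
  where open ≡-Reasoning

run-split : ∀ i ℓ m → run 0 (i + (ℓ + m)) ≡ run 0 i ++ run i ℓ ++ run (i + ℓ) m
run-split i ℓ m = trans (run-++ 0 i (ℓ + m)) (cong (run 0 i ++_) (run-++ i ℓ m))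

map-run : ∀ {h : ℕ → ℕ} i j m → (∀ {t} → t < m → h (i + suc t) ≡ j + suc t) → map h (run i m) ≡ run j m
map-run {h} i j m translate = begin
  map h (run i m)                       ≡⟨ map-∘ (upTo m) ⟨
  map (λ t → h (i + suc t)) (upTo m)    ≡⟨ map-cong-local (All.tabulate (translate ∘ ∈-upTo⁻)) ⟩
  run j m                               ∎
  where open ≡-Reasoning

-- Shifting entries

Outside : ℕ → ℕ → ℕ → Set
Outside i ℓ x = x ≤ i ⊎ i + ℓ < x

module _ {i ℓ : ℕ} where

  shiftUp-≤ : ∀ {x} → x ≤ i → shiftUp i ℓ x ≡ x
  shiftUp-≤ = if-≤ᵇ-≤

  shiftUp-> : ∀ {x} → i < x → shiftUp i ℓ x ≡ x + ℓ
  shiftUp-> = if-≤ᵇ->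

  shiftDown-≤ : ∀ {x} → x ≤ i → shiftDown i ℓ x ≡ x
  shiftDown-≤ = if-≤ᵇ-≤

  shiftDown-> : ∀ {x} → i < x → shiftDown i ℓ x ≡ x ∸ ℓ
  shiftDown-> = if-≤ᵇ->

  shiftUp-mono-< : shiftUp i ℓ Preserves _<_ ⟶ _<_
  shiftUp-mono-< {x} {y} x<y with x ≤? i | y ≤? i
  ... | yes x≤i | yes y≤i rewrite shiftUp-≤ x≤i | shiftUp-≤ y≤i = x<y
  ... | yes x≤i | no  y≰i rewrite shiftUp-≤ x≤i | shiftUp-> (≰⇒> y≰i) = <-≤-trans x<y (m≤m+n y ℓ)
  ... | no  x≰i | yes y≤i = contradiction (<-trans (≰⇒> x≰i) x<y) (≤⇒≯ y≤i)
  ... | no  x≰i | no  y≰i rewrite shiftUp-> (≰⇒> x≰i) | shiftUp-> (≰⇒> y≰i) = +-monoˡ-< ℓ x<y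

  shiftUp-outside : ∀ x → Outside i ℓ (shiftUp i ℓ x)
  shiftUp-outside x with x ≤? i
  ... | yes x≤i rewrite shiftUp-≤ x≤i = inj₁ x≤i
  ... | no  x≰i rewrite shiftUp-> (≰⇒> x≰i) = inj₂ (+-monoˡ-< ℓ (≰⇒> x≰i))

  shiftUp-shiftDown : ∀ {x} → Outside i ℓ x → shiftUp i ℓ (shiftDown i ℓ x) ≡ x
  shiftUp-shiftDown (inj₁ x≤i) rewrite shiftDown-≤ x≤i = shiftUp-≤ x≤i
  shiftUp-shiftDown (inj₂ i+ℓ<x) rewrite shiftDown-> (≤-trans (m≤m+n (suc i) ℓ) i+ℓ<x) =
    trans (shiftUp-> (m+n≤o⇒m≤o∸n (suc i) i+ℓ<x)) (m∸n+n≡m (≤-trans (m≤n+m ℓ i) (<⇒≤ i+ℓ<x)))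

  shiftDown-mono-< : ∀ {x y} → Outside i ℓ x → Outside i ℓ y → x < y → shiftDown i ℓ x < shiftDown i ℓ y
  shiftDown-mono-< out-x out-y x<y = ≰⇒> λ gy≤gx → <⇒≱ x<y
    (subst₂ _≤_ (shiftUp-shiftDown out-y) (shiftUp-shiftDown out-x) (strictMono⇒mono shiftUp-mono-< gy≤gx))

  shiftDown-cancel-< : ∀ {x y} → Outside i ℓ x → Outside i ℓ y → shiftDown i ℓ x < shiftDown i ℓ y → x < y
  shiftDown-cancel-< out-x out-y gx<gy =
    subst₂ _<_ (shiftUp-shiftDown out-x) (shiftUp-shiftDown out-y) (shiftUp-mono-< gx<gy)

outside-∉-run : ∀ {i ℓ x} → Outside i ℓ x → x ∉ run i ℓ
outside-∉-run (inj₁ x≤i)   x∈ = <⇒≱ (proj₁ (∈-run⁻ x∈)) x≤i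
outside-∉-run (inj₂ i+ℓ<x) x∈ = <⇒≱ i+ℓ<x (proj₂ (∈-run⁻ x∈))

run-++-outside : ∀ {i ℓ m x} → x ∈ run 0 i ++ run (i + ℓ) m → Outside i ℓ x
run-++-outside {i} x∈ with ∈-++⁻ (run 0 i) x∈
... | inj₁ x∈low  = inj₁ (proj₂ (∈-run⁻ x∈low))
... | inj₂ x∈high = inj₂ (proj₁ (∈-run⁻ x∈high))

shiftUp-run : ∀ i ℓ m → map (shiftUp i ℓ) (run 0 (i + m)) ≡ run 0 i ++ run (i + ℓ) m
shiftUp-run i ℓ m = begin
  map f (run 0 (i + m))                ≡⟨ cong (map f) (run-++ 0 i m) ⟩
  map f (run 0 i ++ run i m)           ≡⟨ map-++ f (run 0 i) (run i m) ⟩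
  map f (run 0 i) ++ map f (run i m)   ≡⟨ cong₂ _++_ (map-run 0 0 i shiftUp-≤) (map-run i (i + ℓ) m shifted) ⟩
  run 0 i ++ run (i + ℓ) m             ∎
  where
  open ≡-Reasoning
  f : ℕ → ℕ
  f = shiftUp i ℓ
  shifted : ∀ {t} → t < m → f (i + suc t) ≡ i + ℓ + suc t
  shifted {t} _ = trans (shiftUp-> (m<m+n i z<s)) (xy∙z≈xz∙y i (suc t) ℓ)

shiftDown-run : ∀ i ℓ m → map (shiftDown i ℓ) (run 0 i ++ run (i + ℓ) m) ≡ run 0 (i + m)
shiftDown-run i ℓ m = begin
  map g (run 0 i ++ run (i + ℓ) m)           ≡⟨ map-++ g (run 0 i) (run (i + ℓ) m) ⟩
  map g (run 0 i) ++ map g (run (i + ℓ) m)   ≡⟨ cong₂ _++_ (map-run 0 0 i (shiftDown-≤ {ℓ = ℓ}))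
                                                            (map-run (i + ℓ) i m shifted) ⟩
  run 0 i ++ run i m                         ≡⟨ run-++ 0 i m ⟨
  run 0 (i + m)                              ∎
  where
  open ≡-Reasoning
  g : ℕ → ℕ
  g = shiftDown i ℓ
  shifted : ∀ {t} → t < m → g (i + ℓ + suc t) ≡ i + suc t
  shifted {t} _ = begin
    g (i + ℓ + suc t)     ≡⟨ shiftDown-> {ℓ = ℓ} (≤-<-trans (m≤m+n i ℓ) (m<m+n (i + ℓ) z<s)) ⟩
    i + ℓ + suc t ∸ ℓ     ≡⟨ cong (_∸ ℓ) (xy∙z≈xz∙y i (suc t) ℓ) ⟨
    i + suc t + ℓ ∸ ℓ     ≡⟨ m+n∸n≡m (i + suc t) ℓ ⟩
    i + suc t             ∎

-- Standard s-partitions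

std⁺ : ∀ {P m} → All NonEmpty P → concat P ↭ run 0 m → IsStdSPart P
std⁺ {P} ne p = ne , subst (λ n → concat P ↭ run 0 n) (sym (trans (↭-length p) (length-run 0 _))) p

∈-std⁻ : ∀ {P x} → IsStdSPart P → x ∈ concat P → 1 ≤ x × x ≤ size P
∈-std⁻ (_ , p) x∈ = ∈-run⁻ (∈-resp-↭ p x∈)

∈-std⁺ : ∀ {P x} → IsStdSPart P → 1 ≤ x → x ≤ size P → x ∈ concat P
∈-std⁺ (_ , p) 1≤x x≤n = ∈-resp-↭ (↭-sym p) (∈-run⁺ 1≤x x≤n)

std-unique : ∀ {P} → IsStdSPart P → Unique (concat P)
std-unique {P} (_ , p) = PermutationSetoid.Unique-resp-↭ (setoid ℕ) (↭⇒↭ₛ (↭-sym p)) (run-unique 0 (size P))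

insertRun-↭ : ∀ {i ℓ m} P → concat P ↭ run 0 (i + m) → concat (insertRun i ℓ P) ↭ run 0 (i + (ℓ + m))
insertRun-↭ {i} {ℓ} {m} P p = begin
  run i ℓ ++ concat (map (map f) P)     ≡⟨ cong (run i ℓ ++_) (concat-map P) ⟩
  run i ℓ ++ map f (concat P)           ↭⟨ ++⁺ˡ (run i ℓ) (map⁺ f p) ⟩
  run i ℓ ++ map f (run 0 (i + m))      ≡⟨ cong (run i ℓ ++_) (shiftUp-run i ℓ m) ⟩
  run i ℓ ++ run 0 i ++ run (i + ℓ) m   ↭⟨ shifts (run i ℓ) (run 0 i) ⟩
  run 0 i ++ run i ℓ ++ run (i + ℓ) m   ≡⟨ run-split i ℓ m ⟨
  run 0 (i + (ℓ + m))                   ∎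
  where
  open PermutationReasoning
  f : ℕ → ℕ
  f = shiftUp i ℓ

deleteRun-↭ : ∀ xs ys {i ℓ n} → 1 ≤ ℓ → xs ++ run i ℓ ++ ys ↭ run 0 n →
              ∃ λ m → xs ++ ys ↭ run 0 i ++ run (i + ℓ) m
deleteRun-↭ xs ys {i} {ℓ} {n} 1≤ℓ p = m , ++-cancelˡ-↭ (run i ℓ) (begin
  run i ℓ ++ xs ++ ys                   ↭⟨ shifts (run i ℓ) xs ⟩
  xs ++ run i ℓ ++ ys                   ↭⟨ p ⟩
  run 0 n                               ≡⟨ cong (run 0) n≡ ⟨
  run 0 (i + (ℓ + m))                   ≡⟨ run-split i ℓ m ⟩
  run 0 i ++ run i ℓ ++ run (i + ℓ) m   ↭⟨ shifts (run 0 i) (run i ℓ) ⟩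
  run i ℓ ++ run 0 i ++ run (i + ℓ) m   ∎)
  where
  open PermutationReasoning
  i+ℓ≤n : i + ℓ ≤ n
  i+ℓ≤n = proj₂ (∈-run⁻ (∈-resp-↭ p (∈-++⁺ʳ xs (∈-++⁺ˡ (∈-run⁺ (m<m+n i 1≤ℓ) ≤-refl)))))
  m : ℕ
  m = proj₁ (m≤n⇒∃[o]m+o≡n i+ℓ≤n)
  n≡ : i + (ℓ + m) ≡ n
  n≡ = trans (sym (+-assoc i ℓ m)) (proj₂ (m≤n⇒∃[o]m+o≡n i+ℓ≤n))

-- Crossing blocks

-- B and C occur at distinct positions of an s-partition (as lists they may coincide).
data TwoBlocks : SPart → List ℕ → List ℕ → Set where
  headˡ : ∀ {P B C} → C ∈ P → TwoBlocks (B ∷ P) B C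
  headʳ : ∀ {P B C} → B ∈ P → TwoBlocks (C ∷ P) B C
  tail  : ∀ {P A B C} → TwoBlocks P B C → TwoBlocks (A ∷ P) B C

TwoBlocks-sym : TwoBlocks P B C → TwoBlocks P C B
TwoBlocks-sym (headˡ C∈) = headʳ C∈
TwoBlocks-sym (headʳ B∈) = headˡ B∈
TwoBlocks-sym (tail t)   = tail (TwoBlocks-sym t)

TwoBlocks-∈ˡ : TwoBlocks P B C → B ∈ P
TwoBlocks-∈ˡ (headˡ _)  = here refl
TwoBlocks-∈ˡ (headʳ B∈) = there B∈
TwoBlocks-∈ˡ (tail t)   = there (TwoBlocks-∈ˡ t)

TwoBlocks-∈ʳ : TwoBlocks P B C → C ∈ P
TwoBlocks-∈ʳ = TwoBlocks-∈ˡ ∘ TwoBlocks-sym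

TwoBlocks⁺ : B ∈ P → C ∈ P → B ≢ C → TwoBlocks P B C
TwoBlocks⁺ (here refl) (here refl) B≢C = contradiction refl B≢C
TwoBlocks⁺ (here refl) (there C∈)  _   = headˡ C∈
TwoBlocks⁺ (there B∈)  (here refl) _   = headʳ B∈
TwoBlocks⁺ (there B∈)  (there C∈)  B≢C = tail (TwoBlocks⁺ B∈ C∈ B≢C)

TwoBlocks-disjoint : Unique (concat P) → TwoBlocks P B C → ∀ {x} → x ∈ B → x ∉ C
TwoBlocks-disjoint u (headˡ C∈) x∈B x∈C = unique-++-disjoint _ u x∈B (∈-concat⁺′ x∈C C∈)
TwoBlocks-disjoint u (headʳ B∈) x∈B x∈C = unique-++-disjoint _ u x∈C (∈-concat⁺′ x∈B B∈)
TwoBlocks-disjoint {P = A ∷ _} u (tail t) = TwoBlocks-disjoint (unique-++ʳ A u) t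

TwoBlocks-index : TwoBlocks P B C →
                  ∃₂ λ (j k : Fin (length P)) → j ≢ k × lookup P j ≡ B × lookup P k ≡ C
TwoBlocks-index (headˡ C∈) = zero , suc (index C∈) , (λ ()) , refl , sym (lookup-index C∈)
TwoBlocks-index (headʳ B∈) = suc (index B∈) , zero , (λ ()) , sym (lookup-index B∈) , refl
TwoBlocks-index (tail t) with j , k , j≢k , B≡ , C≡ ← TwoBlocks-index t =
  suc j , suc k , j≢k ∘ Fin.suc-injective , B≡ , C≡

TwoBlocks-lookup : ∀ P {j k : Fin (length P)} → j ≢ k → TwoBlocks P (lookup P j) (lookup P k)
TwoBlocks-lookup (_ ∷ _) {zero}  {zero}  j≢k = contradiction refl j≢k
TwoBlocks-lookup (_ ∷ _) {zero}  {suc k} _   = headˡ (∈-lookup k)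
TwoBlocks-lookup (_ ∷ _) {suc j} {zero}  _   = headʳ (∈-lookup j)
TwoBlocks-lookup (_ ∷ P) {suc j} {suc k} j≢k = tail (TwoBlocks-lookup P (j≢k ∘ cong suc))

TwoBlocks-map⁻ : ∀ {h : List ℕ → List ℕ} P {B C} → TwoBlocks (map h P) B C →
                 ∃₂ λ B₀ C₀ → TwoBlocks P B₀ C₀ × B ≡ h B₀ × C ≡ h C₀
TwoBlocks-map⁻ {h} (B₀ ∷ P) (headˡ C∈) with C₀ , C₀∈ , C≡ ← ∈-map⁻ h C∈ =
  B₀ , C₀ , headˡ C₀∈ , refl , C≡
TwoBlocks-map⁻ {h} (C₀ ∷ P) (headʳ B∈) with B₀ , B₀∈ , B≡ ← ∈-map⁻ h B∈ =
  B₀ , C₀ , headʳ B₀∈ , B≡ , refl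
TwoBlocks-map⁻ (_ ∷ P) (tail t) with B₀ , C₀ , t₀ , B≡ , C≡ ← TwoBlocks-map⁻ P t =
  B₀ , C₀ , tail t₀ , B≡ , C≡

TwoBlocks-insert : ∀ Q → TwoBlocks (Q ++ R) B C → TwoBlocks (Q ++ X ∷ R) B C
TwoBlocks-insert []      t          = tail t
TwoBlocks-insert (_ ∷ Q) (headˡ C∈) = headˡ (∈-insert Q C∈)
TwoBlocks-insert (_ ∷ Q) (headʳ B∈) = headʳ (∈-insert Q B∈)
TwoBlocks-insert (_ ∷ Q) (tail t)   = tail (TwoBlocks-insert Q t)

record Crossing (B C : List ℕ) : Set where
  constructor crossing
  field
    a b c d : ℕ
    a<b : a < b
    b<c : b < c
    c<d : c < d
    a∈B : a ∈ B
    c∈B : c ∈ B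
    b∈C : b ∈ C
    d∈C : d ∈ C

PairwiseNonCrossing : SPart → Set
PairwiseNonCrossing P = ∀ {B C} → TwoBlocks P B C → ¬ Crossing B C

NonCrossing⇒pairwise : NonCrossing P → PairwiseNonCrossing P
NonCrossing⇒pairwise nc t (crossing a b c d a<b b<c c<d a∈ c∈ b∈ d∈)
  with j , k , j≢k , refl , refl ← TwoBlocks-index t = nc j k j≢k a b c d a<b b<c c<d a∈ c∈ b∈ d∈

pairwise⇒NonCrossing : PairwiseNonCrossing P → NonCrossing P
pairwise⇒NonCrossing {P} nc j k j≢k a b c d a<b b<c c<d a∈ c∈ b∈ d∈ =
  nc (TwoBlocks-lookup P j≢k) (crossing a b c d a<b b<c c<d a∈ c∈ b∈ d∈)

crossing-map⁻ : ∀ {h : ℕ → ℕ} → (∀ {x y} → x ∈ B ++ C → y ∈ B ++ C → h x < h y → x < y) →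
                Crossing (map h B) (map h C) → Crossing B C
crossing-map⁻ {B} {C} {h} cancel (crossing _ _ _ _ a<b b<c c<d a∈ c∈ b∈ d∈)
  with a , a∈B , refl ← ∈-map⁻ h a∈ | b , b∈C , refl ← ∈-map⁻ h b∈
     | c , c∈B , refl ← ∈-map⁻ h c∈ | d , d∈C , refl ← ∈-map⁻ h d∈ =
  crossing a b c d (cancel (inB a∈B) (inC b∈C) a<b) (cancel (inC b∈C) (inB c∈B) b<c)
    (cancel (inB c∈B) (inC d∈C) c<d) a∈B c∈B b∈C d∈C
  where
  inB : ∀ {x} → x ∈ B → x ∈ B ++ C
  inB = ∈-++⁺ˡ
  inC : ∀ {x} → x ∈ C → x ∈ B ++ C
  inC = ∈-++⁺ʳ B

run-crossingˡ : ∀ {i ℓ} → All (Outside i ℓ) C → ¬ Crossing (run i ℓ) C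
run-crossingˡ out (crossing _ _ _ _ a<b b<c _ a∈ c∈ b∈ _) =
  outside-∉-run (All.lookup out b∈) (run-convex a∈ c∈ a<b b<c)

run-crossingʳ : ∀ {i ℓ} → All (Outside i ℓ) B → ¬ Crossing B (run i ℓ)
run-crossingʳ out (crossing _ _ _ _ _ b<c c<d _ c∈ b∈ d∈) =
  outside-∉-run (All.lookup out c∈) (run-convex b∈ d∈ b<c c<d)

-- Inserting and deleting runs

insertRun-pairwise : ∀ {i ℓ} → PairwiseNonCrossing P → PairwiseNonCrossing (insertRun i ℓ P)
insertRun-pairwise {i = i} {ℓ} nc (headˡ C∈) with C , _ , refl ← ∈-map⁻ (map (shiftUp i ℓ)) C∈ =
  run-crossingˡ (All.map⁺ (All.universal shiftUp-outside C))
insertRun-pairwise {i = i} {ℓ} nc (headʳ B∈) with B , _ , refl ← ∈-map⁻ (map (shiftUp i ℓ)) B∈ =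
  run-crossingʳ (All.map⁺ (All.universal shiftUp-outside B))
insertRun-pairwise {P} nc (tail t) cr with _ , _ , t₀ , refl , refl ← TwoBlocks-map⁻ P t =
  nc t₀ (crossing-map⁻ (λ _ _ → strictMono⇒cancel-< shiftUp-mono-<) cr)

insertRun-NC : ∀ P i ℓ → NC P → i ≤ size P → 1 ≤ ℓ → NC (insertRun i ℓ P)
insertRun-NC P i (suc ℓ) ((ne , p) , linked , nc) i≤n _ =
    std⁺ (run-nonempty i ℓ ∷ All.map⁺ (All.map NonEmpty-map ne)) (insertRun-↭ P p′)
  , run-linked i (suc ℓ) ∷ All.map⁺ (All.map (linked-map (λ _ _ → shiftUp-mono-<)) linked)
  , pairwise⇒NonCrossing (insertRun-pairwise (NonCrossing⇒pairwise nc))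
  where
  p′ : concat P ↭ run 0 (i + proj₁ (m≤n⇒∃[o]m+o≡n i≤n))
  p′ = subst (λ n → concat P ↭ run 0 n) (sym (proj₂ (m≤n⇒∃[o]m+o≡n i≤n))) p

deleteRun-NC : ∀ Q R i ℓ → 1 ≤ ℓ → NC (Q ++ run i ℓ ∷ R) → NC (standardizeAfterDeleting i ℓ (Q ++ R))
deleteRun-NC Q R i ℓ 1≤ℓ ((ne , p) , linked , nc) =
    std⁺ (All.map⁺ (All.map NonEmpty-map (All-remove Q ne))) remaining′
  , All.map⁺ (All.tabulate linked′)
  , pairwise⇒NonCrossing noncrossing′
  where
  g : ℕ → ℕ
  g = shiftDown i ℓ

  remaining : ∃ λ m → concat Q ++ concat R ↭ run 0 i ++ run (i + ℓ) m
  remaining = deleteRun-↭ (concat Q) (concat R) 1≤ℓ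
    (subst (_↭ run 0 (size (Q ++ run i ℓ ∷ R))) (sym (concat-++ Q (run i ℓ ∷ R))) p)

  m : ℕ
  m = proj₁ remaining

  remaining′ : concat (map (map g) (Q ++ R)) ↭ run 0 (i + m)
  remaining′ = begin
    concat (map (map g) (Q ++ R))      ≡⟨ concat-map (Q ++ R) ⟩
    map g (concat (Q ++ R))            ≡⟨ cong (map g) (concat-++ Q R) ⟨
    map g (concat Q ++ concat R)       ↭⟨ map⁺ g (proj₂ remaining) ⟩
    map g (run 0 i ++ run (i + ℓ) m)   ≡⟨ shiftDown-run i ℓ m ⟩
    run 0 (i + m)                      ∎
    where open PermutationReasoning

  outside : ∀ {B x} → B ∈ Q ++ R → x ∈ B → Outside i ℓ x
  outside {x = x} B∈ x∈ =
    run-++-outside (∈-resp-↭ (proj₂ remaining) (subst (x ∈_) (sym (concat-++ Q R)) (∈-concat⁺′ x∈ B∈)))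

  linked′ : ∀ {B} → B ∈ Q ++ R → Linked _<_ (map g B)
  linked′ B∈ = linked-map (λ x∈ y∈ → shiftDown-mono-< (outside B∈ x∈) (outside B∈ y∈))
                          (All.lookup (All-remove Q linked) B∈)

  outside-pair : ∀ {B C x} → TwoBlocks (Q ++ R) B C → x ∈ B ++ C → Outside i ℓ x
  outside-pair {B} t x∈ = [ outside (TwoBlocks-∈ˡ t) , outside (TwoBlocks-∈ʳ t) ]′ (∈-++⁻ B x∈)

  noncrossing′ : PairwiseNonCrossing (map (map g) (Q ++ R))
  noncrossing′ t cr with _ , _ , t₀ , refl , refl ← TwoBlocks-map⁻ (Q ++ R) t =
    NonCrossing⇒pairwise nc (TwoBlocks-insert Q t₀)
      (crossing-map⁻ (λ x∈ y∈ → shiftDown-cancel-< (outside-pair t₀ x∈) (outside-pair t₀ y∈)) cr)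

-- Run-free noncrossing partitions

Gap : List ℕ → Set
Gap B = ∃₂ λ p q → p ∈ B × q ∈ B × suc p < q × suc p ∉ B

run-or-gap : ∀ {x xs} → Linked _<_ (suc x ∷ xs) → (∃ λ ℓ → xs ≡ run (suc x) ℓ) ⊎ Gap (suc x ∷ xs)
run-or-gap {xs = []}         [-]          = inj₁ (0 , refl)
run-or-gap {xs = zero ∷ _}   (() ∷ _)
run-or-gap {x} {suc y ∷ ys}  (x<y ∷ rest) with run-or-gap rest
... | inj₂ (p , q , p∈ , q∈ , 1+p<q , 1+p∉) = inj₂ (p , q , there p∈ , there q∈ , 1+p<q , λ
  { (here 1+p≡1+x) → 1+n≰n (<⇒≤ (subst (suc x <_) (suc-injective 1+p≡1+x) (All.lookup above p∈)))
  ; (there 1+p∈)   → 1+p∉ 1+p∈ })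
  where
  above : All (suc x <_) (suc y ∷ ys)
  above = Linked.Linked⇒All <-trans x<y rest
... | inj₁ (k , refl) with suc x ≟ y
...   | yes refl = inj₁ (suc k , sym (run-suc (suc x) k))
...   | no 1+x≢y = inj₂ (suc x , suc y , here refl , there (here refl) , 2+x<1+y , λ
  { (here 2+x≡1+x) → 1+n≰n (≤-reflexive 2+x≡1+x)
  ; (there 2+x∈)   → <-irrefl refl (All.lookup (Linked.Linked⇒All <-trans 2+x<1+y rest) 2+x∈) })
  where
  2+x<1+y : suc (suc x) < suc y
  2+x<1+y = s≤s (≤∧≢⇒< (s≤s⁻¹ x<y) 1+x≢y)

-- The block of p + 1 lies strictly between p and q: otherwise it would cross B or share p or q with it.
gap-encloses : ∀ {p q} → NC P → B ∈ P → p ∈ B → q ∈ B → suc p < q → suc p ∉ B →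
               ∃ λ C → C ∈ P × All (λ z → p < z × z < q) C
gap-encloses {P} {B} {p} {q} (std , _ , nc) B∈ p∈ q∈ 1+p<q 1+p∉ =
  inner , inner∈ , All.tabulate (λ z∈ → above z∈ , below z∈)
  where
  1+p∈P : suc p ∈ concat P
  1+p∈P = ∈-std⁺ std (s≤s z≤n) (<⇒≤ (<-≤-trans 1+p<q (proj₂ (∈-std⁻ std (∈-concat⁺′ q∈ B∈)))))
  owner : ∃ λ C → suc p ∈ C × C ∈ P
  owner = ∈-concat⁻′ P 1+p∈P
  inner : List ℕ
  inner = proj₁ owner
  1+p∈inner : suc p ∈ inner
  1+p∈inner = proj₁ (proj₂ owner)
  inner∈ : inner ∈ P
  inner∈ = proj₂ (proj₂ owner)
  t : TwoBlocks P B inner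
  t = TwoBlocks⁺ B∈ inner∈ (λ B≡inner → 1+p∉ (subst (suc p ∈_) (sym B≡inner) 1+p∈inner))
  noncrossing : PairwiseNonCrossing P
  noncrossing = NonCrossing⇒pairwise nc
  disjoint : ∀ {x} → x ∈ B → x ∉ inner
  disjoint = TwoBlocks-disjoint (std-unique std) t
  above : ∀ {z} → z ∈ inner → p < z
  above {z} z∈ with <-cmp z p
  ... | tri< z<p _ _ = contradiction (crossing z p (suc p) q z<p (n<1+n p) 1+p<q z∈ 1+p∈inner p∈ q∈)
                                    (noncrossing (TwoBlocks-sym t))
  ... | tri≈ _ refl _ = contradiction z∈ (disjoint p∈)
  ... | tri> _ _ p<z = p<z
  below : ∀ {z} → z ∈ inner → z < q
  below {z} z∈ with <-cmp z q
  ... | tri< z<q _ _ = z<q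
  ... | tri≈ _ refl _ = contradiction z∈ (disjoint q∈)
  ... | tri> _ _ q<z = contradiction (crossing p (suc p) q z (n<1+n p) 1+p<q q<z p∈ q∈ 1+p∈inner z∈)
                                    (noncrossing t)

-- Induction on w: a gap in B puts another block into a window one narrower.
no-block-within : NC P → RunFree P → ∀ w lo → B ∈ P → ¬ All (λ z → lo ≤ z × z < lo + w) B
no-block-within (std , _) _ zero lo B∈ within with All.lookup (proj₁ std) B∈
... | nonempty x _ with lo≤x , x<lo+0 ← All.lookup within (here refl) =
  <⇒≱ (subst (x <_) (+-identityʳ lo) x<lo+0) lo≤x
no-block-within ncP@(std , linked , _) runFree (suc w) lo B∈ within with All.lookup (proj₁ std) B∈
... | nonempty x xs with ∈-std⁻ std (∈-concat⁺′ (here refl) B∈)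
... | s≤s {n = x′} z≤n , _ with run-or-gap (All.lookup linked B∈)
...   | inj₁ (k , refl) = All.lookup runFree B∈ (x′ , suc k , s≤s z≤n , sym (run-suc x′ k))
...   | inj₂ (p , q , p∈ , q∈ , 1+p<q , 1+p∉) with gap-encloses ncP B∈ p∈ q∈ 1+p<q 1+p∉
...     | C , C∈ , enclosed = no-block-within ncP runFree w (suc p) C∈ (All.map narrower enclosed)
  where
  q≤1+p+w : q ≤ suc p + w
  q≤1+p+w = ≤-trans (s≤s⁻¹ (subst (q <_) (+-suc lo w) (proj₂ (All.lookup within q∈))))
                    (+-monoˡ-≤ w (≤-trans (proj₁ (All.lookup within p∈)) (n≤1+n p)))
  narrower : ∀ {z} → p < z × z < q → suc p ≤ z × z < suc p + w
  narrower (p<z , z<q) = p<z , <-≤-trans z<q q≤1+p+w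

runFree⇒empty : ∀ P → NC P → RunFree P → P ≡ []
runFree⇒empty []      _   _       = refl
runFree⇒empty (B ∷ P) ncP runFree =
  contradiction bounded (no-block-within ncP runFree (suc (size (B ∷ P))) 0 (here refl))
  where
  bounded : All (λ z → 0 ≤ z × z < suc (size (B ∷ P))) B
  bounded = All.tabulate λ z∈ →
    z≤n , s≤s (proj₂ (∈-std⁻ {B ∷ P} (proj₁ ncP) (∈-concat⁺′ {xss = B ∷ P} z∈ (here refl))))

corollary10 : RunClosed NC × (∀ P → NC P → RunFree P → P ≡ [])
corollary10 = ((λ _ → proj₁) , insertRun-NC , deleteRun-NC) , runFree⇒empty
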